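{- For all $1\le k<\omega$, we have $\vdash_{\mathcal{H}^{2k+1}} \circ\neg^{2k}\circ p$ but not $\vdash_{\mathcal{H}^{2k-1}} \circ\neg^{2k}\circ p$ (where $p$ is a propositional variable and $\vdash \varphi$ means $\varnothing\vdash\varphi$).
   Context: Let $\Sigma$ be the propositional signature with unary connectives $\neg,\circ$ and binary connectives $\land,\lor,\to$, and let $L$ be the set of $\Sigma$-formulas over a denumerable set $P$ of propositional variables. A (schematic) Set-Fmla Hilbert-style system is a collection of rule schemas $\Gamma/\varphi$ (with finite $\Gamma$; axioms have $\Gamma=\varnothing$), each rule consisting of all substitution instances of its schema; $\Gamma \vdash_{\mathcal{H}} \varphi$ holds iff there is a finite sequence of formulas ending in $\varphi$ each of which belongs to $\Gamma$ or is the conclusion of a rule instance whose premises occur earlier. Fix a Set-Fmla H-system for positive classical logic (the $\{\land,\lor,\to\}$-fragment of classical logic). For $j\in\omega$, $\neg^j$ denotes $j$-fold application of $\neg$. Consider the axiom schemas (Ax10) $p\lor\neg p$; (bc1) $\circ p\to(p\to(\neg p\to q))$; (ci) $\neg\circ p\to(p\land\neg p)$; and (cc)$_j$ $\circ\neg^j\circ p$ for $j\in\omega$. For $k\in\omega$, $\mathcal{H}^k$ is the positive classical system extended with (Ax10), (bc1), (ci) and (cc)$_j$ for all $0\le j\le k$. -}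

module Defs where

open import Data.Nat using (ℕ; zero; suc; _≤_)

data Fmla : Set where
  var  : ℕ → Fmla
  ~_   : Fmla → Fmla
  ∘_   : Fmla → Fmla
  _∧_  : Fmla → Fmla → Fmla
  _∨_  : Fmla → Fmla → Fmla
  _⇒_  : Fmla → Fmla → Fmla

infixr 5 _⇒_
infixr 6 _∨_
infixr 7 _∧_
infix 8 ~_ ∘_

-- ¬^j φ (object-level ¬ is written ~)
¬^ : ℕ → Fmla → Fmla
¬^ zero    φ = φ
¬^ (suc j) φ = ~ (¬^ j φ)

data _⊢[_]_ (Γ : Fmla → Set) (k : ℕ) : Fmla → Set where
  hyp  : ∀ {φ} → Γ φ → Γ ⊢[ k ] φ
  mp   : ∀ {φ ψ} → Γ ⊢[ k ] φ → Γ ⊢[ k ] (φ ⇒ ψ) → Γ ⊢[ k ] ψ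
  ax1  : ∀ p q → Γ ⊢[ k ] (p ⇒ (q ⇒ p))
  ax2  : ∀ p q r → Γ ⊢[ k ] ((p ⇒ q) ⇒ ((p ⇒ (q ⇒ r)) ⇒ (p ⇒ r)))
  ax3  : ∀ p q → Γ ⊢[ k ] (p ⇒ (q ⇒ (p ∧ q)))
  ax4  : ∀ p q → Γ ⊢[ k ] ((p ∧ q) ⇒ p)
  ax5  : ∀ p q → Γ ⊢[ k ] ((p ∧ q) ⇒ q)
  ax6  : ∀ p q → Γ ⊢[ k ] (p ⇒ (p ∨ q))
  ax7  : ∀ p q → Γ ⊢[ k ] (q ⇒ (p ∨ q))
  ax8  : ∀ p q r → Γ ⊢[ k ] ((p ⇒ r) ⇒ ((q ⇒ r) ⇒ ((p ∨ q) ⇒ r)))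
  ax9  : ∀ p q → Γ ⊢[ k ] (p ∨ (p ⇒ q))
  ax10 : ∀ p → Γ ⊢[ k ] (p ∨ ~ p)
  bc1  : ∀ p q → Γ ⊢[ k ] (∘ p ⇒ (p ⇒ (~ p ⇒ q)))
  ci   : ∀ p → Γ ⊢[ k ] (~ ∘ p ⇒ (p ∧ ~ p))
  cc   : ∀ j → j ≤ k → ∀ p → Γ ⊢[ k ] (∘ ¬^ j (∘ p))

∅ : Fmla → Set
∅ _ = Data.Empty.⊥
  where import Data.Empty

⊢[_]_ : ℕ → Fmla → Set
⊢[ k ] φ = ∅ ⊢[ k ] φ

module Submission where

-- The positive half is an instance of (cc). For the negative half, fix m and
-- call a formula inconsistent when it has more than m leading negations. The
-- two-valued valuation in which an inconsistent formula and its negation are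
-- both true and its ∘ is false, everything else being classical, validates
-- H^m: the instances ∘ ¬^j ∘ q of (cc)_j with j ≤ m only mention formulas with
-- at most j leading negations. Below depth m+1 negation is classical and ∘ p
-- is true, so ¬^(m+1) ∘ p is true when m+1 = 2k is even, and ∘ ¬^(2k) ∘ p is
-- false.

open import Defs
open import Data.Bool using (Bool; true; false; not) renaming (_∧_ to _∧ᵇ_; _∨_ to _∨ᵇ_)
open import Data.Bool.Properties using (∧-zeroʳ; ∨-identityʳ; not-involutive)
open import Data.Nat using (ℕ; zero; suc; _≤_; _*_; _+_; _∸_; z≤n; s≤s)
open import Data.Nat.Properties using (*-suc; ≤-pred; <⇒≤; m≤n⇒m≤1+n; ≤-reflexive; m≤m+n)
open import Data.Product using (_×_; _,_)
open import Relation.Nullary using (¬_; contradiction)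
open import Relation.Binary.PropositionalEquality
  using (_≡_; refl; sym; trans; cong; cong₂; subst; module ≡-Reasoning)

infixr 4 _⇒ᵇ_

_⇒ᵇ_ : Bool → Bool → Bool
true  ⇒ᵇ b = b
false ⇒ᵇ _ = true

⇒ᵇ-elim : ∀ {a b} → a ≡ true → (a ⇒ᵇ b) ≡ true → b ≡ true
⇒ᵇ-elim refl a⇒b = a⇒b

ax1-tautology : ∀ a b → (a ⇒ᵇ b ⇒ᵇ a) ≡ true
ax1-tautology false _     = refl
ax1-tautology true  true  = refl
ax1-tautology true  false = refl

ax2-tautology : ∀ a b c → ((a ⇒ᵇ b) ⇒ᵇ (a ⇒ᵇ b ⇒ᵇ c) ⇒ᵇ a ⇒ᵇ c) ≡ true
ax2-tautology false _     _     = refl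
ax2-tautology true  false _     = refl
ax2-tautology true  true  true  = refl
ax2-tautology true  true  false = refl

ax3-tautology : ∀ a b → (a ⇒ᵇ b ⇒ᵇ a ∧ᵇ b) ≡ true
ax3-tautology false _     = refl
ax3-tautology true  true  = refl
ax3-tautology true  false = refl

ax4-tautology : ∀ a b → (a ∧ᵇ b ⇒ᵇ a) ≡ true
ax4-tautology false _     = refl
ax4-tautology true  true  = refl
ax4-tautology true  false = refl

ax5-tautology : ∀ a b → (a ∧ᵇ b ⇒ᵇ b) ≡ true
ax5-tautology false _     = refl
ax5-tautology true  true  = refl
ax5-tautology true  false = refl

ax6-tautology : ∀ a b → (a ⇒ᵇ a ∨ᵇ b) ≡ true
ax6-tautology false _ = refl
ax6-tautology true  _ = refl

ax7-tautology : ∀ a b → (b ⇒ᵇ a ∨ᵇ b) ≡ true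
ax7-tautology _     false = refl
ax7-tautology false true  = refl
ax7-tautology true  true  = refl

ax8-tautology : ∀ a b c → ((a ⇒ᵇ c) ⇒ᵇ (b ⇒ᵇ c) ⇒ᵇ a ∨ᵇ b ⇒ᵇ c) ≡ true
ax8-tautology true  _     false = refl
ax8-tautology true  true  true  = refl
ax8-tautology true  false true  = refl
ax8-tautology false false _     = refl
ax8-tautology false true  true  = refl
ax8-tautology false true  false = refl

ax9-tautology : ∀ a b → (a ∨ᵇ (a ⇒ᵇ b)) ≡ true
ax9-tautology true  _ = refl
ax9-tautology false _ = refl

ax10-tautology : ∀ a b → (a ∨ᵇ not a ∨ᵇ b) ≡ true
ax10-tautology true  _ = refl
ax10-tautology false _ = refl

bc1-tautology : ∀ a b c → (not (a ∧ᵇ b) ⇒ᵇ a ⇒ᵇ not a ∨ᵇ b ⇒ᵇ c) ≡ true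
bc1-tautology false _     _ = refl
bc1-tautology true  true  _ = refl
bc1-tautology true  false _ = refl

ci-tautology : ∀ a b → (not (not (a ∧ᵇ b)) ∨ᵇ false ⇒ᵇ a ∧ᵇ (not a ∨ᵇ b)) ≡ true
ci-tautology false _     = refl
ci-tautology true  true  = refl
ci-tautology true  false = refl

module Valuation (inconsistent : Fmla → Bool) where

  ⟦_⟧ : Fmla → Bool
  ⟦ var _ ⟧ = false
  ⟦ ~ a   ⟧ = not ⟦ a ⟧ ∨ᵇ inconsistent a
  ⟦ ∘ a   ⟧ = not (⟦ a ⟧ ∧ᵇ inconsistent a)
  ⟦ a ∧ b ⟧ = ⟦ a ⟧ ∧ᵇ ⟦ b ⟧
  ⟦ a ∨ b ⟧ = ⟦ a ⟧ ∨ᵇ ⟦ b ⟧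
  ⟦ a ⇒ b ⟧ = ⟦ a ⟧ ⇒ᵇ ⟦ b ⟧

  ⟦~⟧-consistent : ∀ {a} → inconsistent a ≡ false → ⟦ ~ a ⟧ ≡ not ⟦ a ⟧
  ⟦~⟧-consistent {a} eq = trans (cong (not ⟦ a ⟧ ∨ᵇ_) eq) (∨-identityʳ _)

  sound : ∀ {Γ k φ} →
          (∀ {j} q → j ≤ k → inconsistent (¬^ j (∘ q)) ≡ false) →
          (∀ {ψ} → Γ ψ → ⟦ ψ ⟧ ≡ true) →
          Γ ⊢[ k ] φ → ⟦ φ ⟧ ≡ true
  sound {Γ} {k} cc-consistent Γ-true = go
    where
    go : ∀ {φ} → Γ ⊢[ k ] φ → ⟦ φ ⟧ ≡ true
    go (hyp Γφ)     = Γ-true Γφ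
    go (mp ⊢φ ⊢φ⇒ψ) = ⇒ᵇ-elim (go ⊢φ) (go ⊢φ⇒ψ)
    go (ax1 p q)    = ax1-tautology ⟦ p ⟧ ⟦ q ⟧
    go (ax2 p q r)  = ax2-tautology ⟦ p ⟧ ⟦ q ⟧ ⟦ r ⟧
    go (ax3 p q)    = ax3-tautology ⟦ p ⟧ ⟦ q ⟧
    go (ax4 p q)    = ax4-tautology ⟦ p ⟧ ⟦ q ⟧
    go (ax5 p q)    = ax5-tautology ⟦ p ⟧ ⟦ q ⟧
    go (ax6 p q)    = ax6-tautology ⟦ p ⟧ ⟦ q ⟧
    go (ax7 p q)    = ax7-tautology ⟦ p ⟧ ⟦ q ⟧
    go (ax8 p q r)  = ax8-tautology ⟦ p ⟧ ⟦ q ⟧ ⟦ r ⟧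
    go (ax9 p q)    = ax9-tautology ⟦ p ⟧ ⟦ q ⟧
    go (ax10 p)     = ax10-tautology ⟦ p ⟧ (inconsistent p)
    go (bc1 p q)    = bc1-tautology ⟦ p ⟧ (inconsistent p) ⟦ q ⟧
    go (ci p) rewrite cc-consistent {0} p z≤n = ci-tautology ⟦ p ⟧ (inconsistent p)
    go (cc j j≤k p) rewrite cc-consistent p j≤k = cong not (∧-zeroʳ _)

overNegated : ℕ → Fmla → Bool
overNegated zero    (~ _) = true
overNegated (suc m) (~ a) = overNegated m a
overNegated _       _     = false

overNegated-¬^ : ∀ m a → overNegated m (¬^ (suc m) a) ≡ true
overNegated-¬^ zero    a = refl
overNegated-¬^ (suc m) a = overNegated-¬^ m a

overNegated-¬^∘ : ∀ {j m} q → j ≤ m → overNegated m (¬^ j (∘ q)) ≡ false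
overNegated-¬^∘ {zero}  {zero}  q _         = refl
overNegated-¬^∘ {zero}  {suc m} q _         = refl
overNegated-¬^∘ {suc j} {suc m} q (s≤s j≤m) = overNegated-¬^∘ q j≤m

module _ (m : ℕ) where

  open Valuation (overNegated m)

  ⟦¬^⟧-even : ∀ i q → 2 * i ≤ suc m → ⟦ ¬^ (2 * i) (∘ q) ⟧ ≡ ⟦ ∘ q ⟧
  ⟦¬^⟧-even zero    q _          = refl
  ⟦¬^⟧-even (suc i) q 2+2i≤1+m = begin
    ⟦ ¬^ (2 * suc i) (∘ q) ⟧        ≡⟨ cong (λ j → ⟦ ¬^ j (∘ q) ⟧) (*-suc 2 i) ⟩
    ⟦ ~ ~ ¬^ (2 * i) (∘ q) ⟧        ≡⟨ ⟦~⟧-consistent (overNegated-¬^∘ q 1+2i≤m) ⟩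
    not ⟦ ~ ¬^ (2 * i) (∘ q) ⟧      ≡⟨ cong not (⟦~⟧-consistent (overNegated-¬^∘ q 2i≤m)) ⟩
    not (not ⟦ ¬^ (2 * i) (∘ q) ⟧)  ≡⟨ not-involutive _ ⟩
    ⟦ ¬^ (2 * i) (∘ q) ⟧            ≡⟨ ⟦¬^⟧-even i q (m≤n⇒m≤1+n 2i≤m) ⟩
    ⟦ ∘ q ⟧                         ∎
    where
    open ≡-Reasoning
    1+2i≤m : suc (2 * i) ≤ m
    1+2i≤m = ≤-pred (subst (_≤ suc m) (*-suc 2 i) 2+2i≤1+m)
    2i≤m : 2 * i ≤ m
    2i≤m = <⇒≤ 1+2i≤m

  ∘¬^-underivable : ∀ i → suc m ≡ 2 * i → ∀ n → ¬ (⊢[ m ] (∘ ¬^ (suc m) (∘ var n)))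
  ∘¬^-underivable i 1+m≡2i n ⊢∘E = contradiction ⟦∘E⟧-false≡true λ ()
    where
    open ≡-Reasoning
    E : Fmla
    E = ¬^ (suc m) (∘ var n)
    E-true : ⟦ E ⟧ ≡ true
    E-true = subst (λ j → ⟦ ¬^ j (∘ var n) ⟧ ≡ true) (sym 1+m≡2i)
                   (⟦¬^⟧-even i (var n) (≤-reflexive (sym 1+m≡2i)))
    ⟦∘E⟧-false≡true : false ≡ true
    ⟦∘E⟧-false≡true = begin
      false                           ≡⟨ cong₂ (λ a b → not (a ∧ᵇ b)) E-true (overNegated-¬^ m (∘ var n)) ⟨
      not (⟦ E ⟧ ∧ᵇ overNegated m E)  ≡⟨ sound overNegated-¬^∘ (λ ()) ⊢∘E ⟩
      true                            ∎

lemma3 : ∀ (k : ℕ) → 1 ≤ k → ∀ (n : ℕ) →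
    (⊢[ 2 * k + 1 ] (∘ ¬^ (2 * k) (∘ var n)))
      × ¬ (⊢[ 2 * k ∸ 1 ] (∘ ¬^ (2 * k) (∘ var n)))
lemma3 (suc k) _ n =
  cc (2 * suc k) (m≤m+n (2 * suc k) 1) (var n) ,
  ∘¬^-underivable (2 * suc k ∸ 1) (suc k) refl n
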